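{- Let $\mathcal{H}$ be a hypergraph on a finite set $\Omega$ and let $X\subseteq\Omega$ be non-empty. Then: (1) $X$ is an $\mathcal{R}_1$-immune set if and only if $|\Sigma_1(X,A)|\geq 1$ for all hyperedges $A$ with $A\setminus X\neq\emptyset$ and $A\cap X\neq\emptyset$; (2) $X$ is an $\mathcal{R}_2$-immune set if and only if $|\Sigma_2(X,A)|\geq 2$ for all hyperedges $A$ with $A\setminus X\neq\emptyset$ and $A\cap X\neq\emptyset$.
   Context: A hypergraph $\mathcal{H}$ on a finite set $\Omega$ has vertex set $\Omega$ and a set of hyperedges $E(\mathcal{H})$, subsets of $\Omega$ forming a clutter (no hyperedge contains another). Two vertex subsets $X,Y$ are adjacent if some hyperedge contains both; a vertex $v$ is adjacent to $X$ if $\{v\}$ and $X$ are adjacent. Vertices are colored black or white. Rule $\mathcal{R}_1$: at each step, a non-empty set $X$ of black vertices contained in a hyperedge $E$, such that no white vertex outside $E$ is adjacent to $X$, forces all white vertices of $E$ to become black. Rule $\mathcal{R}_2$: at each step, a non-empty set $X$ of black vertices contained in a hyperedge $E$, such that $X$ is not contained in any other hyperedge containing white vertices, forces all white vertices of $E$ to become black. Iterating $\mathcal{R}_i$ from an initial black set $B$ until no change is possible gives a final black set $\mathcal{R}_i^\ast(B)$ independent of the order of steps. A non-empty $I\subseteq\Omega$ is an $\mathcal{R}_i$-immune set if $\mathcal{R}_i^\ast(\Omega\setminus I)=\Omega\setminus I$. For $B\subseteq\Omega$ let $N(B)=\{A\in E(\mathcal{H}): B\subseteq A\}$. For $X\subseteq\Omega$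 and $A\in E(\mathcal{H})$ define $\Sigma_1(X,A)=\{A'\in N(A\setminus X): (A'\cap X)\setminus A\neq\emptyset\}$ and $\Sigma_2(X,A)=\{A'\in N(A\setminus X): A'\cap X\neq\emptyset\}$. -}

module Defs where

open import Data.Nat using (ℕ; _≥_)
open import Data.Fin using (Fin)
open import Data.Fin.Subset using (Subset; _∈_; _∉_; _⊆_; _∩_; _∪_; _─_; ∁; ⁅_⁆; Nonempty; ∣_∣)
open import Data.Fin.Subset.Properties using (_⊆?_; nonempty?)
open import Data.Vec using (tabulate)
open import Data.Bool using (_∧_)
open import Data.Product using (Σ; ∃; _×_; _,_)
open import Relation.Nullary using (¬_; does)
open import Relation.Binary.PropositionalEquality using (_≡_; _≢_)
open import Relation.Binary.Construct.Closure.ReflexiveTransitive using (Star)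

-- The hyperedges form a clutter: no hyperedge is contained in another
-- (in particular the indexing is injective, so the indices are the hyperedges).
record Hypergraph (n : ℕ) : Set where
  field
    m       : ℕ
    edge    : Fin m → Subset n
    clutter : ∀ i j → edge i ⊆ edge j → i ≡ j
open Hypergraph public

module _ {n : ℕ} (H : Hypergraph n) where

  Adjacent : Subset n → Subset n → Set
  Adjacent X Y = ∃ λ e → X ⊆ edge H e × Y ⊆ edge H e

  VAdjacent : Fin n → Subset n → Set
  VAdjacent v X = Adjacent ⁅ v ⁆ X

  data Step₁ (B : Subset n) : Subset n → Set where
    force : (X : Subset n) (e : Fin (m H)) →
            Nonempty X → X ⊆ B → X ⊆ edge H e →
            (∀ v → v ∉ B → v ∉ edge H e → ¬ VAdjacent v X) →
            Step₁ B (B ∪ edge H e)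

  -- One application of rule R2 to the black set B, producing black set B'.
  -- "X is not contained in any other hyperedge containing white vertices".
  data Step₂ (B : Subset n) : Subset n → Set where
    force : (X : Subset n) (e : Fin (m H)) →
            Nonempty X → X ⊆ B → X ⊆ edge H e →
            (∀ e' → e' ≢ e → X ⊆ edge H e' → ¬ (∃ λ v → v ∈ edge H e' × v ∉ B)) →
            Step₂ B (B ∪ edge H e)

  Final : (Subset n → Subset n → Set) → Subset n → Subset n → Set
  Final Step B F = Star Step B F × (∀ F' → Step F F' → F' ≡ F)

  -- I is an R-immune set: I non-empty and R*(Ω ∖ I) = Ω ∖ I, i.e. every
  -- final set reachable from Ω ∖ I equals Ω ∖ I.
  Immune : (Subset n → Subset n → Set) → Subset n → Set
  Immune Step I = Nonempty I × (∀ F → Final Step (∁ I) F → F ≡ ∁ I)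

  R₁-immune R₂-immune : Subset n → Set
  R₁-immune = Immune Step₁
  R₂-immune = Immune Step₂

  -- Σ₁(X,A) and Σ₂(X,A) as subsets of the (indices of) hyperedges.
  -- A' ∈ N(A ∖ X) means A ∖ X ⊆ A'.
  Σ₁ : Subset n → Fin (m H) → Subset (m H)
  Σ₁ X a = tabulate λ a' →
    does ((edge H a ─ X) ⊆? edge H a') ∧ does (nonempty? ((edge H a' ∩ X) ─ edge H a))

  Σ₂ : Subset n → Fin (m H) → Subset (m H)
  Σ₂ X a = tabulate λ a' →
    does ((edge H a ─ X) ⊆? edge H a') ∧ does (nonempty? (edge H a' ∩ X))

{-# OPTIONS --safe #-}
-- From the black set ∁ X a step of either rule forcing in the hyperedge A produces
-- ∁ X ∪ A, which differs from ∁ X exactly when A meets X.  So X is immune iff every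
-- such step is blocked: a step that changes ∁ X could be continued to a final set
-- strictly above ∁ X (constructively only up to double negation, which suffices
-- because equality of subsets is decidable).  Forcing from a smaller set Y ⊆ A ∖ X
-- is only harder, so the step at A is available iff it is available from A ∖ X.
-- For R₁ that step is blocked iff a vertex of X outside A is adjacent to A ∖ X,
-- i.e. Σ₁(X,A) ≠ ∅; for R₂ iff a hyperedge other than A contains A ∖ X and a vertex
-- of X, i.e. Σ₂(X,A) has a member besides A itself.
module Submission where

open import Defs
open import Data.Bool using (Bool; T; _∧_)
import Data.Bool as Bool
open import Data.Bool.Properties using (T-≡; T-∧)
open import Data.Nat using (ℕ; _≤_; _≥_; _≤?_; z≤n; s≤s)
open import Data.Nat.Properties using (≤-trans)
open import Data.Fin using (Fin; zero; _≟_)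
open import Data.Fin.Subset
  using (Subset; inside; outside; _∈_; _∉_; _⊆_; _⊂_; _⊃_; _∩_; _∪_; _─_; _-_; ∁; ⁅_⁆; Nonempty; Empty; ∣_∣)
open import Data.Fin.Subset.Properties
open import Data.Fin.Subset.Induction using (⊃-wellFounded)
open import Data.Product using (_×_; _,_; ∃; proj₂)
import Data.Product as Product
open import Data.Product.Function.NonDependent.Propositional using (_×-⇔_)
open import Data.Sum using ([_,_]′)
open import Data.Vec using (_∷_; tabulate; here; there)
open import Data.Vec.Properties using (≡-dec; lookup∘tabulate; []=⇒lookup; lookup⇒[]=)
open import Function using (_∘_; id)
open import Function.Bundles using (_⇔_; mk⇔; module Equivalence)
import Function.Properties.Equivalence as ⇔
open import Induction.WellFounded using (Acc; acc)
open import Relation.Nullary using (¬_; contradiction; Dec; yes; no; does)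
open import Relation.Nullary.Decidable using (decidable-stable; ¬¬-excluded-middle)
open import Relation.Binary.PropositionalEquality using (_≡_; _≢_; refl; sym; trans; subst; cong)
open import Relation.Binary.Construct.Closure.ReflexiveTransitive using (Star; ε; _◅_)

private
  variable
    n : ℕ
    p q r : Subset n
    x y : Fin n

x∈p─q⁻ : ∀ (p q : Subset n) → x ∈ p ─ q → x ∈ p × x ∉ q
x∈p─q⁻ (inside ∷ p) (outside ∷ q) here = here , λ ()
x∈p─q⁻ {x = zero} (outside ∷ p) (outside ∷ q) ()
x∈p─q⁻ {x = zero} (outside ∷ p) (inside ∷ q) ()
x∈p─q⁻ {x = zero} (inside ∷ p) (inside ∷ q) ()
x∈p─q⁻ (s ∷ p) (t ∷ q) (there x∈) = Product.map there (_∘ drop-there) (x∈p─q⁻ p q x∈)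

p─q⊆∁q : p ─ q ⊆ ∁ q
p─q⊆∁q {p = p} {q} = x∉p⇒x∈∁p ∘ proj₂ ∘ x∈p─q⁻ p q

r⊆∁q∧r⊆p⇒r⊆p─q : r ⊆ ∁ q → r ⊆ p → r ⊆ p ─ q
r⊆∁q∧r⊆p⇒r⊆p─q r⊆∁q r⊆p x∈r = x∈p∧x∉q⇒x∈p─q (r⊆p x∈r) (x∈∁p⇒x∉p (r⊆∁q x∈r))

x∈p⇒⁅x⁆⊆p : x ∈ p → ⁅ x ⁆ ⊆ p
x∈p⇒⁅x⁆⊆p {x = x} {p} x∈p y∈⁅x⁆ = subst (_∈ p) (sym (x∈⁅y⁆⇒x≡y x y∈⁅x⁆)) x∈p

∁p∪q≡∁p⇔q∩p≡∅ : ∁ p ∪ q ≡ ∁ p ⇔ Empty (q ∩ p)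
∁p∪q≡∁p⇔q∩p≡∅ {p = p} {q} = mk⇔ absorbed⇒disjoint disjoint⇒absorbed
  where
  absorbed⇒disjoint : ∁ p ∪ q ≡ ∁ p → Empty (q ∩ p)
  absorbed⇒disjoint eq (x , x∈q∩p) with x∈p∩q⁻ q p x∈q∩p
  ... | x∈q , x∈p = x∈∁p⇒x∉p (subst (x ∈_) eq (q⊆p∪q (∁ p) q x∈q)) x∈p

  disjoint⇒absorbed : Empty (q ∩ p) → ∁ p ∪ q ≡ ∁ p
  disjoint⇒absorbed q∩p≡∅ = ⊆-antisym
    (λ x∈ → [ id , (λ x∈q → x∉p⇒x∈∁p λ x∈p → q∩p≡∅ (_ , x∈p∩q⁺ (x∈q , x∈p))) ]′ (x∈p∪q⁻ (∁ p) q x∈))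
    (p⊆p∪q q)

p⊆q∧p≢q⇒p⊂q : p ⊆ q → p ≢ q → p ⊂ q
p⊆q∧p≢q⇒p⊂q {p = p} {q} p⊆q p≢q = decidable-stable (p ⊂? q) λ p⊄q →
  p≢q (⊆-antisym p⊆q λ {x} x∈q → decidable-stable (x ∈? p) λ x∉p → p⊄q (p⊆q , x , x∈q , x∉p))

nonempty⇒∣p∣≥1 : Nonempty p → ∣ p ∣ ≥ 1
nonempty⇒∣p∣≥1 (x , x∈p) = ≤-trans (s≤s z≤n) (x∈p⇒∣p-x∣<∣p∣ x∈p)

∣p∣≥1⇒nonempty : ∣ p ∣ ≥ 1 → Nonempty p
∣p∣≥1⇒nonempty {n} {p} ∣p∣≥1 = decidable-stable (nonempty? p) λ p≡∅ →
  1≰0 (subst (1 ≤_) (trans (cong ∣_∣ (Empty-unique p≡∅)) (∣⊥∣≡0 n)) ∣p∣≥1)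
  where
  1≰0 : ¬ 1 ≤ 0
  1≰0 ()

x∈p∧y∈p∧y≢x⇒∣p∣≥2 : x ∈ p → y ∈ p → y ≢ x → ∣ p ∣ ≥ 2
x∈p∧y∈p∧y≢x⇒∣p∣≥2 x∈p y∈p y≢x =
  ≤-trans (s≤s (nonempty⇒∣p∣≥1 (_ , x∈p∧x≢y⇒x∈p-y y∈p y≢x))) (x∈p⇒∣p-x∣<∣p∣ x∈p)

∣p∣≥2⇒∃≢ : ∣ p ∣ ≥ 2 → ∀ x → ∃ λ y → y ∈ p × y ≢ x
∣p∣≥2⇒∃≢ {p = p} ∣p∣≥2 x =
  let y , y∈p-x = decidable-stable (nonempty? (p - x)) p-x≢∅
      y∈p , y∉⁅x⁆ = x∈p─q⁻ p ⁅ x ⁆ y∈p-x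
  in y , y∈p , x∉⁅y⁆⇒x≢y y∉⁅x⁆
  where
  p-x≢∅ : ¬ Empty (p - x)
  p-x≢∅ p-x≡∅ = 2≰1 (≤-trans ∣p∣≥2 (subst (∣ p ∣ ≤_) (∣⁅x⁆∣≡1 x) (p⊆q⇒∣p∣≤∣q∣ p⊆⁅x⁆)))
    where
    p⊆⁅x⁆ : p ⊆ ⁅ x ⁆
    p⊆⁅x⁆ {y} y∈p with y ≟ x
    ... | yes refl = x∈⁅x⁆ x
    ... | no y≢x = contradiction (y , x∈p∧x≢y⇒x∈p-y y∈p y≢x) p-x≡∅
    2≰1 : ¬ 2 ≤ 1
    2≰1 (s≤s ())

x∈tabulate⇔T : {f : Fin n → Bool} → x ∈ tabulate f ⇔ T (f x)
x∈tabulate⇔T {x = x} {f} = mk⇔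
  (λ x∈ → Equivalence.from T-≡ (trans (sym (lookup∘tabulate f x)) ([]=⇒lookup x∈)))
  (λ fx → lookup⇒[]= x _ (trans (lookup∘tabulate f x) (Equivalence.to T-≡ fx)))

T-does⇔ : ∀ {A : Set} (A? : Dec A) → T (does A?) ⇔ A
T-does⇔ (yes a) = mk⇔ (λ _ → a) _
T-does⇔ (no ¬a) = mk⇔ (λ ()) ¬a

T-does∧does⇔× : ∀ {P Q : Set} (P? : Dec P) (Q? : Dec Q) → T (does P? ∧ does Q?) ⇔ (P × Q)
T-does∧does⇔× P? Q? = ⇔.trans T-∧ (T-does⇔ P? ×-⇔ T-does⇔ Q?)

Stable : (Subset n → Subset n → Set) → Subset n → Set
Stable Step B = ∀ B' → Step B B' → B' ≡ B

Inflationary : (Subset n → Subset n → Set) → Set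
Inflationary Step = ∀ {B B'} → Step B B' → B ⊆ B'

module Closure (H : Hypergraph n) {Step : Subset n → Subset n → Set}
               (inflationary : Inflationary Step) where

  star-⊆ : ∀ {B F} → Star Step B F → B ⊆ F
  star-⊆ ε = id
  star-⊆ (s ◅ st) = star-⊆ st ∘ inflationary s

  stable⇒star≡ : ∀ {B F} → Stable Step B → Star Step B F → F ≡ B
  stable⇒star≡ stable ε = refl
  stable⇒star≡ stable (s ◅ st) with stable _ s
  ... | refl = stable⇒star≡ stable st

  ¬¬final : ∀ B → ¬ ¬ ∃ (Final H Step B)
  ¬¬final B = go (⊃-wellFounded B)
    where
    go : ∀ {B} → Acc _⊃_ B → ¬ ¬ ∃ (Final H Step B)
    go {B} (acc rs) no-final = ¬¬-excluded-middle {A = ∃ λ B' → Step B B' × B' ≢ B} λ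
      { (yes (B' , s , B'≢B)) → go (rs (p⊆q∧p≢q⇒p⊂q (inflationary s) (B'≢B ∘ sym)))
                                   λ (F , st , fin) → no-final (F , s ◅ st , fin)
      ; (no stuck) → no-final (B , ε , λ B' s →
                       decidable-stable (≡-dec Bool._≟_ B' B) λ B'≢B → stuck (B' , s , B'≢B)) }

  immune⇔stable : ∀ {X} → Immune H Step X ⇔ (Nonempty X × Stable Step (∁ X))
  immune⇔stable {X} = mk⇔
    (λ (X≢∅ , immune) → X≢∅ , λ B' s → decidable-stable (≡-dec Bool._≟_ B' (∁ X)) λ B'≢∁X →
       ¬¬final B' λ (F , st , fin) →
         B'≢∁X (⊆-antisym (subst (B' ⊆_) (immune F (s ◅ st , fin)) (star-⊆ st)) (inflationary s)))
    (λ (X≢∅ , stable) → X≢∅ , λ F (st , _) → stable⇒star≡ stable st)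

step₁-inflationary : {H : Hypergraph n} → Inflationary (Step₁ H)
step₁-inflationary (force _ _ _ _ _ _) = p⊆p∪q _

step₂-inflationary : {H : Hypergraph n} → Inflationary (Step₂ H)
step₂-inflationary (force _ _ _ _ _ _) = p⊆p∪q _

module _ (H : Hypergraph n) (X : Subset n) where

  open Equivalence using (to; from)

  ∈Σ₁⇔ : ∀ {a a'} →
         a' ∈ Σ₁ H X a ⇔ (edge H a ─ X ⊆ edge H a' × Nonempty (edge H a' ∩ X ─ edge H a))
  ∈Σ₁⇔ {a} {a'} = ⇔.trans x∈tabulate⇔T
    (T-does∧does⇔× (edge H a ─ X ⊆? edge H a') (nonempty? (edge H a' ∩ X ─ edge H a)))

  ∈Σ₂⇔ : ∀ {a a'} → a' ∈ Σ₂ H X a ⇔ (edge H a ─ X ⊆ edge H a' × Nonempty (edge H a' ∩ X))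
  ∈Σ₂⇔ {a} {a'} = ⇔.trans x∈tabulate⇔T
    (T-does∧does⇔× (edge H a ─ X ⊆? edge H a') (nonempty? (edge H a' ∩ X)))

  Σ₁≢∅⇔∃outside-neighbour : ∀ {a} →
    Nonempty (Σ₁ H X a) ⇔ ∃ λ v → v ∈ X × v ∉ edge H a × VAdjacent H v (edge H a ─ X)
  Σ₁≢∅⇔∃outside-neighbour {a} = mk⇔
    (λ (a' , a'∈Σ₁) →
      let A─X⊆a' , v , v∈a'∩X─A = to ∈Σ₁⇔ a'∈Σ₁
          v∈a'∩X , v∉A = x∈p─q⁻ (edge H a' ∩ X) (edge H a) v∈a'∩X─A
          v∈a' , v∈X = x∈p∩q⁻ (edge H a') X v∈a'∩X
      in v , v∈X , v∉A , a' , x∈p⇒⁅x⁆⊆p v∈a' , A─X⊆a')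
    (λ (v , v∈X , v∉A , a' , ⁅v⁆⊆a' , A─X⊆a') →
      a' , from ∈Σ₁⇔ (A─X⊆a' , v , x∈p∧x∉q⇒x∈p─q (x∈p∩q⁺ (⁅v⁆⊆a' (x∈⁅x⁆ v) , v∈X)) v∉A))

  stable₁⇔Σ₁≥1 : Stable (Step₁ H) (∁ X) ⇔
    (∀ a → Nonempty (edge H a ─ X) → Nonempty (edge H a ∩ X) → ∣ Σ₁ H X a ∣ ≥ 1)
  stable₁⇔Σ₁≥1 = mk⇔ stable⇒Σ₁≥1 Σ₁≥1⇒stable
    where
    stable⇒Σ₁≥1 : Stable (Step₁ H) (∁ X) →
      ∀ a → Nonempty (edge H a ─ X) → Nonempty (edge H a ∩ X) → ∣ Σ₁ H X a ∣ ≥ 1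
    stable⇒Σ₁≥1 stable a A─X≢∅ A∩X≢∅ =
      nonempty⇒∣p∣≥1 (decidable-stable (nonempty? (Σ₁ H X a)) λ Σ₁≡∅ →
        to ∁p∪q≡∁p⇔q∩p≡∅
           (stable _ (force (edge H a ─ X) a A─X≢∅ p─q⊆∁q (p─q⊆p _ _) λ v v∉∁X v∉A v~A─X →
              Σ₁≡∅ (from Σ₁≢∅⇔∃outside-neighbour (v , x∉∁p⇒x∈p v∉∁X , v∉A , v~A─X))))
           A∩X≢∅)

    Σ₁≥1⇒stable : (∀ a → Nonempty (edge H a ─ X) → Nonempty (edge H a ∩ X) → ∣ Σ₁ H X a ∣ ≥ 1) →
      Stable (Step₁ H) (∁ X)
    Σ₁≥1⇒stable Σ₁≥1 _ (force Y e (y , y∈Y) Y⊆∁X Y⊆E unadjacent) = from ∁p∪q≡∁p⇔q∩p≡∅ λ E∩X≢∅ →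
      let Y⊆E─X = r⊆∁q∧r⊆p⇒r⊆p─q Y⊆∁X Y⊆E
          v , v∈X , v∉E , e' , ⁅v⁆⊆e' , E─X⊆e' =
            to Σ₁≢∅⇔∃outside-neighbour (∣p∣≥1⇒nonempty (Σ₁≥1 e (y , Y⊆E─X y∈Y) E∩X≢∅))
      in unadjacent v (x∈p⇒x∉∁p v∈X) v∉E (e' , ⁅v⁆⊆e' , E─X⊆e' ∘ Y⊆E─X)

  stable₂⇔Σ₂≥2 : Stable (Step₂ H) (∁ X) ⇔
    (∀ a → Nonempty (edge H a ─ X) → Nonempty (edge H a ∩ X) → ∣ Σ₂ H X a ∣ ≥ 2)
  stable₂⇔Σ₂≥2 = mk⇔ stable⇒Σ₂≥2 Σ₂≥2⇒stable
    where
    stable⇒Σ₂≥2 : Stable (Step₂ H) (∁ X) →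
      ∀ a → Nonempty (edge H a ─ X) → Nonempty (edge H a ∩ X) → ∣ Σ₂ H X a ∣ ≥ 2
    stable⇒Σ₂≥2 stable a A─X≢∅ A∩X≢∅ = decidable-stable (2 ≤? ∣ Σ₂ H X a ∣) λ ∣Σ₂∣≱2 →
      to ∁p∪q≡∁p⇔q∩p≡∅
         (stable _ (force (edge H a ─ X) a A─X≢∅ p─q⊆∁q (p─q⊆p _ _)
           λ a' a'≢a A─X⊆a' (v , v∈a' , v∉∁X) → ∣Σ₂∣≱2 (x∈p∧y∈p∧y≢x⇒∣p∣≥2 a∈Σ₂
             (from ∈Σ₂⇔ (A─X⊆a' , v , x∈p∩q⁺ (v∈a' , x∉∁p⇒x∈p v∉∁X))) a'≢a)))
         A∩X≢∅
      where
      a∈Σ₂ : a ∈ Σ₂ H X a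
      a∈Σ₂ = from ∈Σ₂⇔ (p─q⊆p _ _ , A∩X≢∅)

    Σ₂≥2⇒stable : (∀ a → Nonempty (edge H a ─ X) → Nonempty (edge H a ∩ X) → ∣ Σ₂ H X a ∣ ≥ 2) →
      Stable (Step₂ H) (∁ X)
    Σ₂≥2⇒stable Σ₂≥2 _ (force Y e (y , y∈Y) Y⊆∁X Y⊆E blocked) = from ∁p∪q≡∁p⇔q∩p≡∅ λ E∩X≢∅ →
      let Y⊆E─X = r⊆∁q∧r⊆p⇒r⊆p─q Y⊆∁X Y⊆E
          e' , e'∈Σ₂ , e'≢e = ∣p∣≥2⇒∃≢ (Σ₂≥2 e (y , Y⊆E─X y∈Y) E∩X≢∅) e
          E─X⊆e' , v , v∈e'∩X = to ∈Σ₂⇔ e'∈Σ₂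
          v∈e' , v∈X = x∈p∩q⁻ (edge H e') X v∈e'∩X
      in blocked e' e'≢e (E─X⊆e' ∘ Y⊆E─X) (v , v∈e' , x∈p⇒x∉∁p v∈X)

proposition6 : ∀ {n} (H : Hypergraph n) (X : Subset n) → Nonempty X →
    (R₁-immune H X ⇔ (∀ (a : Fin (m H)) → Nonempty (edge H a ─ X) → Nonempty (edge H a ∩ X) → ∣ Σ₁ H X a ∣ ≥ 1))
    × (R₂-immune H X ⇔ (∀ (a : Fin (m H)) → Nonempty (edge H a ─ X) → Nonempty (edge H a ∩ X) → ∣ Σ₂ H X a ∣ ≥ 2))
proposition6 H X X≢∅ =
  immune⇔ step₁-inflationary (stable₁⇔Σ₁≥1 H X) , immune⇔ step₂-inflationary (stable₂⇔Σ₂≥2 H X)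
  where
  immune⇔ : ∀ {Step P} → Inflationary Step → Stable Step (∁ X) ⇔ P → Immune H Step X ⇔ P
  immune⇔ inflationary stable⇔P = ⇔.trans (Closure.immune⇔stable H inflationary)
    (mk⇔ (Equivalence.to stable⇔P ∘ proj₂) (λ P → X≢∅ , Equivalence.from stable⇔P P))
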